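{- Let $p\equiv1\pmod4$ be prime, let $K=kp$ be odd ($k$ a positive integer), and let $h$ be an integer with $(h,K)=1$ that is a quadratic nonresidue modulo $p$. Then $\tau_{\mathbf{er}}(h,K)+\tau_{\mathbf{es}}(h,K)\equiv1\pmod2$.
   Context: $\chi_\mu=\left(\frac{\mu}{p}\right)$ is the Legendre symbol. For an integer $x$, $\{x\}_K$ is the unique integer with $x\equiv\{x\}_K\pmod K$ and $0\le\{x\}_K<K$. Define $\tau_{\mathbf{er}}(h,K)=\#\{0<\mu<K:\ p\nmid\mu,\ \mu\text{ even},\ \chi_\mu=1,\ \{h\mu\}_K\text{ odd}\}$ and $\tau_{\mathbf{es}}(h,K)=\#\{0<\mu<K:\ p\nmid\mu,\ \mu\text{ even},\ \chi_\mu=-1,\ \{h\mu\}_K\text{ odd}\}$. -}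

module Defs where

open import Data.Nat as ℕ using (ℕ; zero; suc; _*_; _≡ᵇ_)
open import Data.Nat.DivMod using (_%_)
open import Data.Integer as ℤ using (ℤ; +_; -[1+_])
open import Data.Bool using (Bool; true; false; _∧_; not; if_then_else_)
open import Data.List using (List; upTo; filter; length; map)
open import Data.Bool.ListAction using (any)
open import Relation.Nullary.Decidable using (does; T?)
open import Relation.Binary.PropositionalEquality using (_≡_)

-- reduction modulo a natural number; the modulus 0 case is irrelevant
-- (never used: p is prime and K = k*p with k ≥ 1) and returns a itself.
modN : ℕ → ℕ → ℕ
modN a zero    = a
modN a (suc n) = a % suc n

modZ : ℤ → ℕ → ℕ
modZ x zero    = ℤ.∣ x ∣
modZ x (suc n) = x ℤ.%ℕ suc n

isSquareMod : ℕ → ℕ → Bool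
isSquareMod p a = any (λ x → modN (x * x) p ≡ᵇ modN a p) (upTo p)

legendre : ℕ → ℕ → ℤ
legendre p μ =
  if modN μ p ≡ᵇ 0 then + 0
  else (if isSquareMod p μ then + 1 else -[1+ 0 ])

condᵇ : ℕ → ℤ → ℕ → ℤ → ℕ → Bool
condᵇ p c K h μ =
  not (modN μ p ≡ᵇ 0)
  ∧ (modN μ 2 ≡ᵇ 0)
  ∧ does (legendre p μ ℤ.≟ c)
  ∧ (modN (modZ (h ℤ.* + μ) K) 2 ≡ᵇ 1)

range1 : ℕ → List ℕ
range1 K = filter (λ μ → 0 ℕ.<? μ) (upTo K)

countCond : ℕ → ℤ → ℕ → ℤ → ℕ
countCond p c K h = length (filter (λ μ → T? (condᵇ p c K h μ)) (range1 K))

τer : ℕ → ℤ → ℕ → ℕ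
τer p h K = countCond p (+ 1) K h

τes : ℕ → ℤ → ℕ → ℕ
τes p h K = countCond p -[1+ 0 ] K h

module Submission where

-- Let E be the set of even μ in (0, K) with p ∤ μ. On E the Legendre symbol is ±1, so
-- τer + τes = N, the number of μ ∈ E with {hμ}_K odd. Replacing {hμ}_K by K − {hμ}_K whenever it
-- is odd (K is odd, so the result is even) gives a permutation ψ of E with hμ ≡ ±ψ(μ) (mod K),
-- the sign being − exactly N times. Multiplying over E and cancelling ∏ E, which is prime to p,
-- gives Gauss's congruence h^|E| ≡ (−1)^N (mod p). Now |E| = k(p − 1)/2 with k odd, and Euler's
-- criterion h^((p−1)/2) ≡ −1 for the non-residue h turns the left side into −1 (pairing each x
-- with h/x gives (p − 1)! ≡ h^((p−1)/2), and (p − 1)! ≡ −1 by Wilson); as p > 2, N is odd.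

open import Defs

module Proof where

  open import Data.Bool.Base using (Bool; true; false; T; not; _∧_; _∨_; if_then_else_)
  open import Data.Empty using (⊥-elim)
  open import Data.Integer.Base using (ℤ; +_; -[1+_]; _+_; _-_; -_; _*_; _^_; ∣_∣; 0ℤ; 1ℤ; -1ℤ)
  open import Data.Integer.Coprimality using (coprime-divisor)
  open import Data.Integer.DivMod using (_%ℕ_; _/ℕ_; n%ℕd<d; a≡a%ℕn+[a/ℕn]*n)
  open import Data.Integer.Divisibility.Signed
    using (_∣_; divides; ∣⇒∣ᵤ; ∣ᵤ⇒∣; _∣?_; ∣-refl; ∣-trans; ∣m∣n⇒∣m+n; ∣m⇒∣-m; ∣n⇒∣m*n; ∣m⇒∣m*n)
  import Data.Integer.Properties as ℤ
  open import Data.Integer.Tactic.RingSolver using (solve-∀)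
  open import Data.List.Base using ([]; _∷_; length; filter; upTo; _++_; [_])
  open import Data.List.Membership.Propositional.Properties using (∈-upTo⁺)
  import Data.List.Properties as List
  import Data.List.Relation.Unary.Any as Any
  open import Data.List.Relation.Unary.Any.Properties using (any⁺)
  open import Data.Nat.Base as ℕ using (ℕ; zero; suc; _<_; _≤_; s≤s; NonZero; _≡ᵇ_)
  open import Data.Nat.Coprimality using (Coprime; coprime-Bézout; prime⇒coprime) renaming (sym to coprime-sym)
  open import Data.Nat.DivMod as ℕ using (_%_; _/_)
  import Data.Nat.Divisibility as ℕ
  open import Data.Nat.GCD using (module Bézout)
  open import Data.Nat.Primality using (Prime; euclidsLemma; prime⇒nonTrivial; prime⇒nonZero)
  import Data.Nat.Properties as ℕ
  import Data.Nat.Tactic.RingSolver as ℕ-Solver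
  open import Data.Product.Base as Product using (_×_; _,_; proj₁; proj₂; Σ-syntax)
  open import Data.Sum.Base as Sum using (_⊎_; inj₁; inj₂; [_,_]′)
  open import Function.Base using (_∘_)
  open import Relation.Binary.Bundles using (Setoid)
  open import Relation.Binary.PropositionalEquality
    using (_≡_; _≢_; refl; sym; trans; cong; cong₂; subst; module ≡-Reasoning)
  open import Relation.Nullary.Decidable using (Dec; does; yes; no; map′; dec-true; dec-false; T?)
  open import Relation.Nullary.Negation using (¬_; contradiction)
  import Relation.Unary as U
  open import Algebra.Properties.CommutativeSemigroup ℤ.*-commutativeSemigroup using (x∙yz≈y∙xz; interchange)

  ≡ᵇ-true⇒≡ : ∀ {m n} → (m ≡ᵇ n) ≡ true → m ≡ n
  ≡ᵇ-true⇒≡ {m} {n} eq = ℕ.≡ᵇ⇒≡ m n (subst T (sym eq) _)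

  ≡⇒≡ᵇ-true : ∀ {m n} → m ≡ n → (m ≡ᵇ n) ≡ true
  ≡⇒≡ᵇ-true {m} {n} = dec-true (m ℕ.≟ n)

  ≢⇒≡ᵇ-false : ∀ {m n} → m ≢ n → (m ≡ᵇ n) ≡ false
  ≢⇒≡ᵇ-false {m} {n} = dec-false (m ℕ.≟ n)

  ≡ᵇ-false⇒≢ : ∀ {m n} → (m ≡ᵇ n) ≡ false → m ≢ n
  ≡ᵇ-false⇒≢ eq m≡n = contradiction (trans (sym (≡⇒≡ᵇ-true m≡n)) eq) λ ()

  parity : ∀ n → n % 2 ≡ 0 ⊎ n % 2 ≡ 1
  parity n with n % 2 | ℕ.m%n<n n 2
  ... | 0           | _             = inj₁ refl
  ... | 1           | _             = inj₂ refl
  ... | suc (suc _) | s≤s (s≤s ())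

  double%2 : ∀ m → (m ℕ.+ m) % 2 ≡ 0
  double%2 zero    = refl
  double%2 (suc m) rewrite ℕ.+-suc m m = double%2 m

  suc-double%2 : ∀ m → suc (m ℕ.+ m) % 2 ≡ 1
  suc-double%2 zero    = refl
  suc-double%2 (suc m) rewrite ℕ.+-suc m m = suc-double%2 m

  pos-∸ : ∀ {m n} → n ≤ m → + (m ℕ.∸ n) ≡ + m - + n
  pos-∸ {m} {n} n≤m = sym (trans (ℤ.m-n≡m⊖n m n) (ℤ.⊖-≥ n≤m))

  pos-+-* : ∀ a b c d e → a ℕ.+ b ℕ.* c ≡ d ℕ.* e → + a + + b * + c ≡ + d * + e
  pos-+-* a b c d e eq = begin
    + a + + b * + c   ≡⟨ cong (_+_ (+ a)) (ℤ.pos-* b c) ⟨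
    + a + + (b ℕ.* c) ≡⟨ ℤ.pos-+ a (b ℕ.* c) ⟨
    + (a ℕ.+ b ℕ.* c) ≡⟨ cong +_ eq ⟩
    + (d ℕ.* e)       ≡⟨ ℤ.pos-* d e ⟩
    + d * + e         ∎
    where open ≡-Reasoning

  even : ℕ → Bool
  even n = n % 2 ≡ᵇ 0

  private
    %2-distrib-+ : ∀ m n → (m ℕ.+ n) % 2 ≡ (m % 2 ℕ.+ n % 2) % 2
    %2-distrib-+ m n = ℕ.%-distribˡ-+ m n 2

  even-odd+ : ∀ {n} i → n % 2 ≡ 1 → even (n ℕ.+ i) ≡ not (even i)
  even-odd+ {n} i n%2≡1 with parity i
  ... | inj₁ i%2≡0 rewrite %2-distrib-+ n i | n%2≡1 | i%2≡0 = refl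
  ... | inj₂ i%2≡1 rewrite %2-distrib-+ n i | n%2≡1 | i%2≡1 = refl

  -1^n : ∀ n → -1ℤ ^ n ≡ (if even n then 1ℤ else -1ℤ)
  -1^n zero          = refl
  -1^n (suc zero)    = refl
  -1^n (suc (suc n)) = trans (identity (-1ℤ ^ n)) (-1^n n)
    where
    identity : ∀ x → -1ℤ * (-1ℤ * x) ≡ x
    identity = solve-∀

  -1^odd : ∀ {n} → n % 2 ≡ 1 → -1ℤ ^ n ≡ -1ℤ
  -1^odd {n} n%2≡1 rewrite -1^n n | n%2≡1 = refl

  -1^even : ∀ {n} → n % 2 ≡ 0 → -1ℤ ^ n ≡ 1ℤ
  -1^even {n} n%2≡0 rewrite -1^n n | n%2≡0 = refl

  odd-factorˡ : ∀ k p → (k ℕ.* p) % 2 ≡ 1 → k % 2 ≡ 1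
  odd-factorˡ k p kp%2≡1 with parity k
  ... | inj₁ k%2≡0 = contradiction (trans (sym (trans (ℕ.%-distribˡ-* k p 2) (cong (λ a → (a ℕ.* (p % 2)) % 2) k%2≡0))) kp%2≡1) λ ()
  ... | inj₂ k%2≡1 = k%2≡1

  %4≡1⇒%2≡1 : ∀ {p} → p % 4 ≡ 1 → p % 2 ≡ 1
  %4≡1⇒%2≡1 {p} p%4≡1 = trans (cong (_% 2) p≡1+4q) (suc-double%2 (q ℕ.* 2))
    where
    q = p / 4
    identity : ∀ q → 1 ℕ.+ q ℕ.* 4 ≡ suc (q ℕ.* 2 ℕ.+ q ℕ.* 2)
    identity = ℕ-Solver.solve-∀
    p≡1+4q : p ≡ suc (q ℕ.* 2 ℕ.+ q ℕ.* 2)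
    p≡1+4q = trans (ℕ.m≡m%n+[m/n]*n p 4) (trans (cong (ℕ._+ q ℕ.* 4) p%4≡1) (identity q))

  %2≡1⇒≡suc-double : ∀ {p} → p % 2 ≡ 1 → p ≡ suc (p / 2 ℕ.+ p / 2)
  %2≡1⇒≡suc-double {p} p%2≡1 = trans (ℕ.m≡m%n+[m/n]*n p 2) (trans (cong (ℕ._+ p / 2 ℕ.* 2) p%2≡1) (identity (p / 2)))
    where
    identity : ∀ q → 1 ℕ.+ q ℕ.* 2 ≡ suc (q ℕ.+ q)
    identity = ℕ-Solver.solve-∀

  -- Congruences of integers

  infix 4 _≡_mod_

  record _≡_mod_ (a b : ℤ) (n : ℕ) : Set where
    constructor mod-intro
    field divides-difference : + n ∣ a - b

  open _≡_mod_

  module _ {n : ℕ} where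

    private
      via : ∀ {a b c} → c ≡ a - b → + n ∣ c → a ≡ b mod n
      via {c = c} eq n∣c = mod-intro (subst (+ n ∣_) eq n∣c)

    ≡⇒mod : ∀ {a b} → a ≡ b → a ≡ b mod n
    ≡⇒mod {a} refl = via (sym (ℤ.+-inverseʳ a)) (divides 0ℤ refl)

    mod-refl : ∀ {a} → a ≡ a mod n
    mod-refl = ≡⇒mod refl

    mod-sym : ∀ {a b} → a ≡ b mod n → b ≡ a mod n
    mod-sym {a} {b} (mod-intro d) = via (identity a b) (∣m⇒∣-m d)
      where
      identity : ∀ a b → - (a - b) ≡ b - a
      identity = solve-∀

    mod-trans : ∀ {a b c} → a ≡ b mod n → b ≡ c mod n → a ≡ c mod n
    mod-trans {a} {b} {c} (mod-intro d) (mod-intro e) = via (identity a b c) (∣m∣n⇒∣m+n d e)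
      where
      identity : ∀ a b c → (a - b) + (b - c) ≡ a - c
      identity = solve-∀

    +-cong-mod : ∀ {a b c d} → a ≡ b mod n → c ≡ d mod n → a + c ≡ b + d mod n
    +-cong-mod {a} {b} {c} {d} (mod-intro x) (mod-intro y) = via (identity a b c d) (∣m∣n⇒∣m+n x y)
      where
      identity : ∀ a b c d → (a - b) + (c - d) ≡ (a + c) - (b + d)
      identity = solve-∀

    *-cong-mod : ∀ {a b c d} → a ≡ b mod n → c ≡ d mod n → a * c ≡ b * d mod n
    *-cong-mod {a} {b} {c} {d} (mod-intro x) (mod-intro y) =
      via (identity a b c d) (∣m∣n⇒∣m+n (∣m⇒∣m*n c x) (∣n⇒∣m*n b y))
      where
      identity : ∀ a b c d → (a - b) * c + b * (c - d) ≡ a * c - b * d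
      identity = solve-∀

    *-congˡ-mod : ∀ a {b c} → b ≡ c mod n → a * b ≡ a * c mod n
    *-congˡ-mod a = *-cong-mod (mod-refl {a})

    *-congʳ-mod : ∀ c {a b} → a ≡ b mod n → a * c ≡ b * c mod n
    *-congʳ-mod c a≡b = *-cong-mod a≡b (mod-refl {c})

    neg-cong-mod : ∀ {a b} → a ≡ b mod n → - a ≡ - b mod n
    neg-cong-mod {a} {b} (mod-intro x) = via (identity a b) (∣m⇒∣-m x)
      where
      identity : ∀ a b → - (a - b) ≡ - a - - b
      identity = solve-∀

    ^-cong-mod : ∀ {a b} m → a ≡ b mod n → a ^ m ≡ b ^ m mod n
    ^-cong-mod zero    _   = mod-refl
    ^-cong-mod (suc m) a≡b = *-cong-mod a≡b (^-cong-mod m a≡b)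

    ∣⇒≡0-mod : ∀ {a} → + n ∣ a → a ≡ 0ℤ mod n
    ∣⇒≡0-mod {a} = via (sym (ℤ.+-identityʳ a))

    ≡0-mod⇒∣ : ∀ {a} → a ≡ 0ℤ mod n → + n ∣ a
    ≡0-mod⇒∣ {a} (mod-intro d) = subst (+ n ∣_) (ℤ.+-identityʳ a) d

    %ℕ-mod : ∀ a .{{_ : NonZero n}} → + (a %ℕ n) ≡ a mod n
    %ℕ-mod a = via (trans (identity r (a /ℕ n) (+ n)) (cong (_-_ r) (sym (a≡a%ℕn+[a/ℕn]*n a n))))
                   (∣m⇒∣-m (∣n⇒∣m*n (a /ℕ n) ∣-refl))
      where
      r = + (a %ℕ n)
      identity : ∀ r q n → - (q * n) ≡ r - (r + q * n)
      identity = solve-∀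

    private
      mod⇒%≡-≥ : ∀ {a b} .{{_ : NonZero n}} → b ≤ a → + a ≡ + b mod n → a % n ≡ b % n
      mod⇒%≡-≥ {a} {b} b≤a (mod-intro d) = begin
        a % n                 ≡⟨ cong (_% n) (ℕ.m+[n∸m]≡n b≤a) ⟨
        (b ℕ.+ (a ℕ.∸ b)) % n ≡⟨ ℕ.%-remove-+ʳ b n∣a∸b ⟩
        b % n                 ∎
        where
        open ≡-Reasoning
        n∣a∸b : n ℕ.∣ a ℕ.∸ b
        n∣a∸b = subst (n ℕ.∣_) (cong ∣_∣ (sym (pos-∸ b≤a))) (∣⇒∣ᵤ d)

    mod⇒%≡ : ∀ {a b} .{{_ : NonZero n}} → + a ≡ + b mod n → a % n ≡ b % n
    mod⇒%≡ {a} {b} a≡b with ℕ.≤-total b a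
    ... | inj₁ b≤a = mod⇒%≡-≥ b≤a a≡b
    ... | inj₂ a≤b = sym (mod⇒%≡-≥ a≤b (mod-sym a≡b))

    mod-unique : ∀ {a b} .{{_ : NonZero n}} → a < n → b < n → + a ≡ + b mod n → a ≡ b
    mod-unique {a} {b} a<n b<n a≡b = begin
      a     ≡⟨ ℕ.m<n⇒m%n≡m a<n ⟨
      a % n ≡⟨ mod⇒%≡ a≡b ⟩
      b % n ≡⟨ ℕ.m<n⇒m%n≡m b<n ⟩
      b     ∎
      where open ≡-Reasoning

  mod-setoid : ℕ → Setoid _ _
  mod-setoid n = record
    { Carrier = ℤ
    ; _≈_ = λ a b → a ≡ b mod n
    ; isEquivalence = record { refl = mod-refl ; sym = mod-sym ; trans = mod-trans }
    }

  module ≡-mod-Reasoning (n : ℕ) where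
    open import Relation.Binary.Reasoning.Setoid (mod-setoid n) public

  infix 4 _≡?_mod_

  _≡?_mod_ : ∀ a b n → Dec (a ≡ b mod n)
  a ≡? b mod n = map′ mod-intro divides-difference (+ n ∣? a - b)

  %≡⇒mod : ∀ {n a b} .{{_ : NonZero n}} → a % n ≡ b → + a ≡ + b mod n
  %≡⇒mod {a = a} a%n≡b = mod-trans (mod-sym (%ℕ-mod (+ a))) (≡⇒mod (cong +_ a%n≡b))

  ≡0-mod⇒%≡0 : ∀ {n a} .{{_ : NonZero n}} → + a ≡ 0ℤ mod n → a % n ≡ 0
  ≡0-mod⇒%≡0 {n} a≡0 = trans (mod⇒%≡ a≡0) (ℕ.m<n⇒m%n≡m (ℕ.>-nonZero⁻¹ n))

  mod-divisor : ∀ {m n a b} → m ℕ.∣ n → a ≡ b mod n → a ≡ b mod m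
  mod-divisor m∣n (mod-intro d) = mod-intro (∣-trans (∣ᵤ⇒∣ m∣n) d)

  pred≡-1-mod : ∀ q → + q ≡ -1ℤ mod suc q
  pred≡-1-mod q = mod-intro (divides 1ℤ (begin
    + q + 1ℤ     ≡⟨ ℤ.pos-+ q 1 ⟨
    + (q ℕ.+ 1)  ≡⟨ cong +_ (ℕ.+-comm q 1) ⟩
    + suc q      ≡⟨ ℤ.*-identityˡ (+ suc q) ⟨
    1ℤ * + suc q ∎))
    where open ≡-Reasoning

  odd∸odd : ∀ {m n} → n ≤ m → m % 2 ≡ 1 → n % 2 ≡ 1 → (m ℕ.∸ n) % 2 ≡ 0
  odd∸odd {m} {n} n≤m m%2≡1 n%2≡1 = ≡0-mod⇒%≡0 (begin
    + (m ℕ.∸ n)  ≡⟨ pos-∸ n≤m ⟩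
    + m - + n    ≈⟨ +-cong-mod (%≡⇒mod {a = m} m%2≡1) (neg-cong-mod (%≡⇒mod {a = n} n%2≡1)) ⟩
    1ℤ - 1ℤ      ∎)
    where open ≡-mod-Reasoning 2

  even+even : ∀ {m n} → m % 2 ≡ 0 → n % 2 ≡ 0 → (m ℕ.+ n) % 2 ≡ 0
  even+even {m} {n} m%2≡0 n%2≡0 = begin
    (m ℕ.+ n) % 2           ≡⟨ ℕ.%-distribˡ-+ m n 2 ⟩
    (m % 2 ℕ.+ n % 2) % 2   ≡⟨ cong₂ (λ a b → (a ℕ.+ b) % 2) m%2≡0 n%2≡0 ⟩
    0                       ∎
    where open ≡-Reasoning

  1≢-1-mod : ∀ {p} → 2 < p → ¬ 1ℤ ≡ -1ℤ mod p
  1≢-1-mod 2<p (mod-intro p∣2) = ℕ.<⇒≱ 2<p (ℕ.∣⇒≤ (∣⇒∣ᵤ p∣2))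

  -1^N≡-1⇒odd : ∀ {p N} → 2 < p → -1ℤ ^ N ≡ -1ℤ mod p → N % 2 ≡ 1
  -1^N≡-1⇒odd {N = N} 2<p sign≡-1 with parity N
  ... | inj₁ N%2≡0 = contradiction (mod-trans (≡⇒mod (sym (-1^even {N} N%2≡0))) sign≡-1) (1≢-1-mod 2<p)
  ... | inj₂ N%2≡1 = N%2≡1

  odd-prime⇒>2 : ∀ {p m} → Prime p → p ≡ suc (m ℕ.+ m) → 2 < p
  odd-prime⇒>2 {p} {m} p-prime p≡1+2m = ℕ.≤∧≢⇒< (ℕ.nonTrivial⇒n>1 p {{prime⇒nonTrivial p-prime}}) 2≢p
    where
    2≢p : 2 ≢ p
    2≢p 2≡p with () ← trans (cong (_% 2) (trans 2≡p p≡1+2m)) (suc-double%2 m)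

  -- Products and counts over {i < n ∣ P i}

  count : ℕ → (ℕ → Bool) → ℕ
  count zero    P = 0
  count (suc n) P = if P n then suc (count n P) else count n P

  prod : ℕ → (ℕ → Bool) → (ℕ → ℤ) → ℤ
  prod zero    P f = 1ℤ
  prod (suc n) P f = if P n then f n * prod n P f else prod n P f

  remove : ℕ → (ℕ → Bool) → ℕ → Bool
  remove x P i = if does (i ℕ.≟ x) then false else P i

  remove-self : ∀ x P → remove x P x ≡ false
  remove-self x P rewrite dec-true (x ℕ.≟ x) refl = refl

  remove-other : ∀ {x i} P → i ≢ x → remove x P i ≡ P i
  remove-other {x} {i} P i≢x rewrite dec-false (i ℕ.≟ x) i≢x = refl

  remove⁺ : ∀ {x i} P → P i ≡ true → i ≢ x → remove x P i ≡ true
  remove⁺ P Pi i≢x = trans (remove-other P i≢x) Pi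

  remove⁻ : ∀ {x i} P → remove x P i ≡ true → P i ≡ true × i ≢ x
  remove⁻ {x} {i} P removeᵢ with i ℕ.≟ x
  ... | yes refl = contradiction (trans (sym (remove-self x P)) removeᵢ) λ ()
  ... | no i≢x   = trans (sym (remove-other P i≢x)) removeᵢ , i≢x

  count-suc-true : ∀ n P → P n ≡ true → count (suc n) P ≡ suc (count n P)
  count-suc-true n P Pn rewrite Pn = refl

  count-suc-false : ∀ n P → P n ≡ false → count (suc n) P ≡ count n P
  count-suc-false n P Pn rewrite Pn = refl

  count-ext : ∀ n {P Q} → (∀ {i} → i < n → P i ≡ Q i) → count n P ≡ count n Q
  count-ext zero    P≡Q = refl
  count-ext (suc n) P≡Q
    rewrite P≡Q (ℕ.n<1+n n) | count-ext n (P≡Q ∘ ℕ.m<n⇒m<1+n) = refl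

  prod-ext : ∀ n {P Q} f → (∀ {i} → i < n → P i ≡ Q i) → prod n P f ≡ prod n Q f
  prod-ext zero    f P≡Q = refl
  prod-ext (suc n) f P≡Q
    rewrite P≡Q (ℕ.n<1+n n) | prod-ext n f (P≡Q ∘ ℕ.m<n⇒m<1+n) = refl

  private
    remove-below : ∀ {n x} P → n ≤ x → ∀ {i} → i < n → P i ≡ remove x P i
    remove-below P n≤x i<n = sym (remove-other P (ℕ.<⇒≢ (ℕ.<-≤-trans i<n n≤x)))

  count-remove : ∀ {n P x} → x < n → P x ≡ true → count n P ≡ suc (count n (remove x P))
  count-remove {suc n} {P} {x} x<1+n Px with ℕ.m<1+n⇒m<n∨m≡n x<1+n
  ... | inj₂ refl rewrite remove-self x P | Px = cong suc (count-ext x (remove-below P ℕ.≤-refl))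
  ... | inj₁ x<n rewrite remove-other P (ℕ.>⇒≢ x<n) with P n
  ...   | true  = cong suc (count-remove x<n Px)
  ...   | false = count-remove x<n Px

  prod-remove : ∀ {n P x} f → x < n → P x ≡ true → prod n P f ≡ f x * prod n (remove x P) f
  prod-remove {suc n} {P} {x} f x<1+n Px with ℕ.m<1+n⇒m<n∨m≡n x<1+n
  ... | inj₂ refl rewrite remove-self x P | Px = cong (f x *_) (prod-ext x f (remove-below P ℕ.≤-refl))
  ... | inj₁ x<n rewrite remove-other P (ℕ.>⇒≢ x<n) with P n
  ...   | true  = trans (cong (f n *_) (prod-remove f x<n Px)) (x∙yz≈y∙xz (f n) (f x) _)
  ...   | false = prod-remove f x<n Px

  count≡suc⇒member : ∀ {n P m} → count n P ≡ suc m → Σ[ x ∈ ℕ ] x < n × P x ≡ true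
  count≡suc⇒member {suc n} {P} eq with P n in Pn
  ... | true  = n , ℕ.n<1+n n , Pn
  ... | false with x , x<n , Px ← count≡suc⇒member eq = x , ℕ.m<n⇒m<1+n x<n , Px

  count≡0⇒prod≡1 : ∀ n {P} f → count n P ≡ 0 → prod n P f ≡ 1ℤ
  count≡0⇒prod≡1 zero    f _ = refl
  count≡0⇒prod≡1 (suc n) {P} f eq with P n
  ... | false = count≡0⇒prod≡1 n f eq

  MapsTo : ℕ → (ℕ → Bool) → (ℕ → Bool) → (ℕ → ℕ) → Set
  MapsTo n S T ψ = ∀ {x} → x < n → S x ≡ true → ψ x < n × T (ψ x) ≡ true

  InjectiveOn : ℕ → (ℕ → Bool) → (ℕ → ℕ) → Set
  InjectiveOn n S ψ = ∀ {x y} → x < n → y < n → S x ≡ true → S y ≡ true → ψ x ≡ ψ y → x ≡ y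

  private
    count-remove-pred : ∀ {n P x m} → x < n → P x ≡ true → count n P ≡ suc m → count n (remove x P) ≡ m
    count-remove-pred x<n Px #P = ℕ.suc-injective (trans (sym (count-remove x<n Px)) #P)

    prod-reindex-by-count : ∀ m {n S T} ψ f → count n S ≡ m → count n T ≡ m →
                            MapsTo n S T ψ → InjectiveOn n S ψ → prod n S (f ∘ ψ) ≡ prod n T f
    prod-reindex-by-count zero {n} ψ f #S #T _ _ =
      trans (count≡0⇒prod≡1 n (f ∘ ψ) #S) (sym (count≡0⇒prod≡1 n f #T))
    prod-reindex-by-count (suc m) {n} {S} {T} ψ f #S #T maps inj
      with x , x<n , Sx ← count≡suc⇒member #S
      with ψx<n , Tψx ← maps x<n Sx = begin
        prod n S (f ∘ ψ)                      ≡⟨ prod-remove (f ∘ ψ) x<n Sx ⟩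
        f (ψ x) * prod n (remove x S) (f ∘ ψ) ≡⟨ cong (f (ψ x) *_) IH ⟩
        f (ψ x) * prod n (remove (ψ x) T) f   ≡⟨ prod-remove f ψx<n Tψx ⟨
        prod n T f                            ∎
      where
      open ≡-Reasoning
      maps′ : MapsTo n (remove x S) (remove (ψ x) T) ψ
      maps′ z<n S′z with Sz , z≢x ← remove⁻ S S′z with ψz<n , Tψz ← maps z<n Sz =
        ψz<n , remove⁺ T Tψz (z≢x ∘ inj z<n x<n Sz Sx)
      inj′ : InjectiveOn n (remove x S) ψ
      inj′ y<n z<n S′y S′z = inj y<n z<n (proj₁ (remove⁻ S S′y)) (proj₁ (remove⁻ S S′z))
      IH : prod n (remove x S) (f ∘ ψ) ≡ prod n (remove (ψ x) T) f
      IH = prod-reindex-by-count m ψ f (count-remove-pred x<n Sx #S) (count-remove-pred ψx<n Tψx #T) maps′ inj′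

  prod-reindex : ∀ {n S T} ψ f → count n S ≡ count n T → MapsTo n S T ψ → InjectiveOn n S ψ →
                 prod n S (f ∘ ψ) ≡ prod n T f
  prod-reindex ψ f #S≡#T = prod-reindex-by-count _ ψ f refl (sym #S≡#T)

  record Pairing (q n : ℕ) (S : ℕ → Bool) (f : ℕ → ℤ) (c : ℤ) : Set where
    field
      partner            : ℕ → ℕ
      partner-mapsTo     : MapsTo n S S partner
      partner-involutive : ∀ {x} → x < n → S x ≡ true → partner (partner x) ≡ x
      partner-≢          : ∀ {x} → x < n → S x ≡ true → partner x ≢ x
      partner-product    : ∀ {x} → x < n → S x ≡ true → f x * f (partner x) ≡ c mod q

  remove-pair : ∀ {q n S f c} (pairing : Pairing q n S f c) → let open Pairing pairing in
                ∀ {x} → x < n → S x ≡ true → Pairing q n (remove (partner x) (remove x S)) f c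
  remove-pair {n = n} {S} pairing {x} x<n Sx = record
    { partner            = partner
    ; partner-mapsTo     = mapsTo′
    ; partner-involutive = λ z<n → partner-involutive z<n ∘ inS
    ; partner-≢          = λ z<n → partner-≢ z<n ∘ inS
    ; partner-product    = λ z<n → partner-product z<n ∘ inS
    }
    where
    open Pairing pairing
    S₁ = remove x S
    S₂ = remove (partner x) S₁
    inS : ∀ {z} → S₂ z ≡ true → S z ≡ true
    inS = proj₁ ∘ remove⁻ S ∘ proj₁ ∘ remove⁻ S₁
    mapsTo′ : MapsTo n S₂ S₂ partner
    mapsTo′ {z} z<n S₂z with S₁z , z≢y ← remove⁻ S₁ S₂z with Sz , z≢x ← remove⁻ S S₁z
      with w<n , Sw ← partner-mapsTo z<n Sz = w<n , remove⁺ S₁ (remove⁺ S Sw w≢x) w≢y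
      where
      w≢x : partner z ≢ x
      w≢x w≡x = z≢y (trans (sym (partner-involutive z<n Sz)) (cong partner w≡x))
      w≢y : partner z ≢ partner x
      w≢y w≡y = z≢x (trans (sym (partner-involutive z<n Sz)) (trans (cong partner w≡y) (partner-involutive x<n Sx)))

  prod-pairing : ∀ {q n S f c} m → Pairing q n S f c → count n S ≡ m ℕ.+ m → prod n S f ≡ c ^ m mod q
  prod-pairing {n = n} {f = f} zero _ #S = ≡⇒mod (count≡0⇒prod≡1 n f #S)
  prod-pairing {q} {n} {S} {f} {c} (suc m) pairing #S
    with x , x<n , Sx ← count≡suc⇒member #S
    with y<n , Sy ← Pairing.partner-mapsTo pairing x<n Sx = begin
      prod n S f                    ≡⟨ prod-remove f x<n Sx ⟩
      f x * prod n S₁ f             ≡⟨ cong (f x *_) (prod-remove f y<n S₁y) ⟩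
      f x * (f y * prod n S₂ f)     ≡⟨ ℤ.*-assoc (f x) (f y) _ ⟨
      f x * f y * prod n S₂ f       ≈⟨ *-cong-mod (partner-product x<n Sx) (prod-pairing m (remove-pair pairing x<n Sx) #S₂) ⟩
      c * c ^ m                     ∎
    where
    open Pairing pairing
    open ≡-mod-Reasoning q
    y = partner x
    S₁ = remove x S
    S₂ = remove y S₁
    S₁y : S₁ y ≡ true
    S₁y = remove⁺ S Sy (partner-≢ x<n Sx)
    #S₂ : count n S₂ ≡ m ℕ.+ m
    #S₂ = count-remove-pred y<n S₁y (count-remove-pred x<n Sx (trans #S (ℕ.+-suc (suc m) m)))

  prod-* : ∀ n P f g → prod n P (λ i → f i * g i) ≡ prod n P f * prod n P g
  prod-* zero    P f g = refl
  prod-* (suc n) P f g with P n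
  ... | true  = trans (cong (f n * g n *_) (prod-* n P f g)) (interchange (f n) (g n) _ _)
  ... | false = prod-* n P f g

  prod-const : ∀ n P c → prod n P (λ _ → c) ≡ c ^ count n P
  prod-const zero    P c = refl
  prod-const (suc n) P c with P n
  ... | true  = cong (c *_) (prod-const n P c)
  ... | false = prod-const n P c

  prod-sign : ∀ n (P Q : ℕ → Bool) → prod n P (λ i → if Q i then -1ℤ else 1ℤ) ≡ -1ℤ ^ count n (λ i → P i ∧ Q i)
  prod-sign zero    P Q = refl
  prod-sign (suc n) P Q with P n | Q n
  ... | true  | true  = cong (-1ℤ *_) (prod-sign n P Q)
  ... | true  | false = trans (ℤ.*-identityˡ _) (prod-sign n P Q)
  ... | false | _     = prod-sign n P Q

  prod-cong-mod : ∀ {q} n {P} f g → (∀ {i} → i < n → P i ≡ true → f i ≡ g i mod q) →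
                  prod n P f ≡ prod n P g mod q
  prod-cong-mod zero        f g f≡g = mod-refl
  prod-cong-mod (suc n) {P} f g f≡g with P n in Pn
  ... | true  = *-cong-mod (f≡g (ℕ.n<1+n n) Pn) (prod-cong-mod n f g (f≡g ∘ ℕ.m<n⇒m<1+n))
  ... | false = prod-cong-mod n f g (f≡g ∘ ℕ.m<n⇒m<1+n)

  count-+ : ∀ a b P → count (a ℕ.+ b) P ≡ count a P ℕ.+ count b (λ i → P (a ℕ.+ i))
  count-+ a zero    P rewrite ℕ.+-identityʳ a = sym (ℕ.+-identityʳ (count a P))
  count-+ a (suc b) P rewrite ℕ.+-suc a b with P (a ℕ.+ b)
  ... | true  = trans (cong suc (count-+ a b P)) (sym (ℕ.+-suc (count a P) _))
  ... | false = count-+ a b P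

  count-periodic : ∀ d P → (∀ i → P (d ℕ.+ i) ≡ P i) → ∀ j → count (j ℕ.* d) P ≡ j ℕ.* count d P
  count-periodic d P periodic zero    = refl
  count-periodic d P periodic (suc j) = begin
    count (d ℕ.+ j ℕ.* d) P                                   ≡⟨ count-+ d (j ℕ.* d) P ⟩
    count d P ℕ.+ count (j ℕ.* d) (λ i → P (d ℕ.+ i))         ≡⟨ cong (count d P ℕ.+_) (count-ext (j ℕ.* d) (λ {i} _ → periodic i)) ⟩
    count d P ℕ.+ count (j ℕ.* d) P                           ≡⟨ cong (count d P ℕ.+_) (count-periodic d P periodic j) ⟩
    count d P ℕ.+ j ℕ.* count d P                             ∎
    where open ≡-Reasoning

  count-partition : ∀ n {P Q R} → (∀ {i} → i < n → R i ≡ P i ∨ Q i) → (∀ {i} → i < n → P i ∧ Q i ≡ false) →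
                    count n P ℕ.+ count n Q ≡ count n R
  count-partition zero _ _ = refl
  count-partition (suc n) {P} {Q} {R} R≡P∨Q disjoint
    rewrite R≡P∨Q (ℕ.n<1+n n)
    with P n | Q n | disjoint (ℕ.n<1+n n)
       | count-partition n (R≡P∨Q ∘ ℕ.m<n⇒m<1+n) (disjoint ∘ ℕ.m<n⇒m<1+n)
  ... | true  | false | _ | IH = cong suc IH
  ... | false | true  | _ | IH = trans (ℕ.+-suc (count n P) (count n Q)) (cong suc IH)
  ... | false | false | _ | IH = IH

  positive : ℕ → Bool
  positive zero    = false
  positive (suc _) = true

  positive⁻ : ∀ {x} → positive x ≡ true → 0 < x
  positive⁻ {suc _} _ = ℕ.z<s

  positive⁺ : ∀ {x} → 0 < x → positive x ≡ true
  positive⁺ ℕ.z<s = refl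

  count-positive : ∀ n → count (suc n) positive ≡ n
  count-positive zero    = refl
  count-positive (suc n) = cong suc (count-positive n)

  count-positive-even : ∀ m → count (suc (m ℕ.+ m)) (λ i → positive i ∧ even i) ≡ m
  count-positive-even zero    = refl
  count-positive-even (suc m) = begin
    count (suc (suc m ℕ.+ suc m)) P      ≡⟨ cong (λ n → count (suc n) P) (ℕ.+-suc (suc m) m) ⟩
    count (suc (suc (suc (m ℕ.+ m)))) P  ≡⟨ count-suc-true (suc (suc (m ℕ.+ m))) P (≡⇒≡ᵇ-true (double%2 m)) ⟩
    suc (count (suc (suc (m ℕ.+ m))) P)  ≡⟨ cong suc (count-suc-false (suc (m ℕ.+ m)) P (cong (_≡ᵇ 0) (suc-double%2 m))) ⟩
    suc (count (suc (m ℕ.+ m)) P)        ≡⟨ cong suc (count-positive-even m) ⟩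
    suc m                                ∎
    where
    open ≡-Reasoning
    P : ℕ → Bool
    P i = positive i ∧ even i

  search : ℕ → {P : ℕ → Set} → U.Decidable P → ℕ
  search zero    P? = 0
  search (suc n) P? = if does (P? n) then n else search n P?

  search-sound : ∀ n {P : ℕ → Set} (P? : U.Decidable P) {y : ℕ} → y < n → P y → search n P? < n × P (search n P?)
  search-sound (suc n) P? y<1+n Py with P? n
  ... | yes Pn = ℕ.n<1+n n , Pn
  ... | no ¬Pn with ℕ.m<1+n⇒m<n∨m≡n y<1+n
  ...   | inj₁ y<n  = Product.map₁ ℕ.m<n⇒m<1+n (search-sound n P? y<n Py)
  ...   | inj₂ refl = contradiction Py ¬Pn

  QuadraticNonResidue : ℕ → ℤ → Set
  QuadraticNonResidue p a = ∀ x → x < p → ¬ + x * + x ≡ a mod p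

  -- Arithmetic modulo a prime: Wilson's theorem and Euler's criterion

  module _ {p : ℕ} (p-prime : Prime p) where

    private instance
      p≢0 : NonZero p
      p≢0 = prime⇒nonZero p-prime

    prime-∣-* : ∀ a b → + p ∣ a * b → (+ p ∣ a) ⊎ (+ p ∣ b)
    prime-∣-* a b p∣ab =
      Sum.map ∣ᵤ⇒∣ ∣ᵤ⇒∣ (euclidsLemma ∣ a ∣ ∣ b ∣ p-prime (subst (p ℕ.∣_) (ℤ.abs-* a b) (∣⇒∣ᵤ p∣ab)))

    *-≢0-mod : ∀ {a b} → ¬ a ≡ 0ℤ mod p → ¬ b ≡ 0ℤ mod p → ¬ a * b ≡ 0ℤ mod p
    *-≢0-mod {a} {b} a≢0 b≢0 ab≡0 with prime-∣-* a b (≡0-mod⇒∣ ab≡0)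
    ... | inj₁ p∣a = a≢0 (∣⇒≡0-mod p∣a)
    ... | inj₂ p∣b = b≢0 (∣⇒≡0-mod p∣b)

    mod-cancelʳ : ∀ {a b c} → ¬ c ≡ 0ℤ mod p → a * c ≡ b * c mod p → a ≡ b mod p
    mod-cancelʳ {a} {b} {c} c≢0 (mod-intro d) =
      [ mod-intro , (λ p∣c → contradiction (∣⇒≡0-mod p∣c) c≢0) ]′
        (prime-∣-* (a - b) c (subst (+ p ∣_) (identity a b c) d))
      where
      identity : ∀ a b c → a * c - b * c ≡ (a - b) * c
      identity = solve-∀

    1≢0-mod : ¬ 1ℤ ≡ 0ℤ mod p
    1≢0-mod 1≡0 = ℕ.nonTrivial⇒≢1 {{prime⇒nonTrivial p-prime}} (ℕ.∣1⇒≡1 (∣⇒∣ᵤ (≡0-mod⇒∣ 1≡0)))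

    small-≢0-mod : ∀ {x} → 0 < x → x < p → ¬ + x ≡ 0ℤ mod p
    small-≢0-mod {x} 0<x x<p x≡0 = ℕ.<⇒≢ 0<x (sym (mod-unique x<p (ℕ.>-nonZero⁻¹ p) x≡0))

    mod-inverse : ∀ {x} → 0 < x → x < p → Σ[ u ∈ ℤ ] + x * u ≡ 1ℤ mod p
    mod-inverse {x@(suc _)} _ x<p with coprime-Bézout (prime⇒coprime p-prime x<p)
    ... | Bézout.+- a b eq = - + b , mod-intro (divides (- + a) (begin
      + x * - + b - 1ℤ    ≡⟨ identity (+ b) (+ x) ⟩
      - (1ℤ + + b * + x)  ≡⟨ cong -_ (pos-+-* 1 b x a p eq) ⟩
      - (+ a * + p)       ≡⟨ ℤ.neg-distribˡ-* (+ a) (+ p) ⟩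
      - + a * + p         ∎))
      where
      open ≡-Reasoning
      identity : ∀ b x → x * - b - 1ℤ ≡ - (1ℤ + b * x)
      identity = solve-∀
    ... | Bézout.-+ a b eq = + b , mod-intro (divides (+ a) (begin
      + x * + b - 1ℤ          ≡⟨ cong (_- 1ℤ) (ℤ.*-comm (+ x) (+ b)) ⟩
      + b * + x - 1ℤ          ≡⟨ cong (_- 1ℤ) (pos-+-* 1 a p b x eq) ⟨
      1ℤ + + a * + p - 1ℤ     ≡⟨ identity (+ a * + p) ⟩
      + a * + p               ∎))
      where
      open ≡-Reasoning
      identity : ∀ t → 1ℤ + t - 1ℤ ≡ t
      identity = solve-∀

    mod-cancel-small : ∀ {x y z} → 0 < x → x < p → y < p → z < p → + x * + y ≡ + x * + z mod p → y ≡ z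
    mod-cancel-small {x} {y} {z} 0<x x<p y<p z<p xy≡xz = mod-unique y<p z<p (mod-cancelʳ (small-≢0-mod 0<x x<p) (begin
      + y * + x ≡⟨ ℤ.*-comm (+ y) (+ x) ⟩
      + x * + y ≈⟨ xy≡xz ⟩
      + x * + z ≡⟨ ℤ.*-comm (+ x) (+ z) ⟩
      + z * + x ∎))
      where open ≡-mod-Reasoning p

    square≡1⇒≡±1 : ∀ {x} → x * x ≡ 1ℤ mod p → (x ≡ 1ℤ mod p) ⊎ (x ≡ -1ℤ mod p)
    square≡1⇒≡±1 {x} (mod-intro p∣x²-1) =
      Sum.map mod-intro (mod-intro ∘ subst (+ p ∣_) (identity₂ x))
              (prime-∣-* (x - 1ℤ) (x + 1ℤ) (subst (+ p ∣_) (identity₁ x) p∣x²-1))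
      where
      identity₁ : ∀ x → x * x - 1ℤ ≡ (x - 1ℤ) * (x + 1ℤ)
      identity₁ = solve-∀
      identity₂ : ∀ x → x + 1ℤ ≡ x - -1ℤ
      identity₂ = solve-∀

    prod-≢0-mod : ∀ n {P} f → (∀ {i} → i < n → P i ≡ true → ¬ f i ≡ 0ℤ mod p) → ¬ prod n P f ≡ 0ℤ mod p
    prod-≢0-mod zero        f f≢0 = 1≢0-mod
    prod-≢0-mod (suc n) {P} f f≢0 with P n in Pn
    ... | true  = *-≢0-mod (f≢0 (ℕ.n<1+n n) Pn) (prod-≢0-mod n f (f≢0 ∘ ℕ.m<n⇒m<1+n))
    ... | false = prod-≢0-mod n f (f≢0 ∘ ℕ.m<n⇒m<1+n)

    -- The y < p with x * y ≡ c (mod p); search returns the junk value 0 when there is none.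
    quotientMod : ℤ → ℕ → ℕ
    quotientMod c x = search p (λ y → + x * + y ≡? c mod p)

    quotientMod-spec : ∀ c {x} → 0 < x → x < p → quotientMod c x < p × + x * + quotientMod c x ≡ c mod p
    quotientMod-spec c {x} 0<x x<p with u , xu≡1 ← mod-inverse 0<x x<p =
      search-sound p (λ y → + x * + y ≡? c mod p) (n%ℕd<d (u * c) p) (begin
        + x * + ((u * c) %ℕ p) ≈⟨ *-congˡ-mod (+ x) (%ℕ-mod (u * c)) ⟩
        + x * (u * c)          ≡⟨ ℤ.*-assoc (+ x) u c ⟨
        + x * u * c            ≈⟨ *-congʳ-mod c xu≡1 ⟩
        1ℤ * c                 ≡⟨ ℤ.*-identityˡ c ⟩
        c                      ∎)
      where open ≡-mod-Reasoning p

    quotientMod-positive : ∀ {c x} → ¬ c ≡ 0ℤ mod p → 0 < x → x < p → 0 < quotientMod c x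
    quotientMod-positive {c} {x} c≢0 0<x x<p = ℕ.n≢0⇒n>0 λ y≡0 → c≢0 (begin
      c                       ≈⟨ proj₂ (quotientMod-spec c 0<x x<p) ⟨
      + x * + quotientMod c x ≡⟨ cong (λ y → + x * + y) y≡0 ⟩
      + x * 0ℤ                ≡⟨ ℤ.*-zeroʳ (+ x) ⟩
      0ℤ                      ∎)
      where open ≡-mod-Reasoning p

    quotientMod-involutive : ∀ {c x} → ¬ c ≡ 0ℤ mod p → 0 < x → x < p → quotientMod c (quotientMod c x) ≡ x
    quotientMod-involutive {c} {x} c≢0 0<x x<p = mod-cancel-small 0<y y<p z<p x<p (begin
      + y * + quotientMod c y ≈⟨ proj₂ (quotientMod-spec c 0<y y<p) ⟩
      c                       ≈⟨ proj₂ (quotientMod-spec c 0<x x<p) ⟨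
      + x * + y               ≡⟨ ℤ.*-comm (+ x) (+ y) ⟩
      + y * + x               ∎)
      where
      open ≡-mod-Reasoning p
      y = quotientMod c x
      y<p = proj₁ (quotientMod-spec c 0<x x<p)
      0<y = quotientMod-positive c≢0 0<x x<p
      z<p = proj₁ (quotientMod-spec c 0<y y<p)

    private
      1<p : 1 < p
      1<p = ℕ.nonTrivial⇒n>1 p {{prime⇒nonTrivial p-prime}}

    module _ {q : ℕ} (p≡1+q : p ≡ suc q) {x : ℕ} (0<x : 0 < x) (x<p : x < p) where

      private
        q<p : q < p
        q<p = subst (q <_) (sym p≡1+q) (ℕ.n<1+n q)

        q≡-1 : + q ≡ -1ℤ mod p
        q≡-1 = subst (λ n → + q ≡ -1ℤ mod n) (sym p≡1+q) (pred≡-1-mod q)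

        ≡1⇒≡1 : + x ≡ 1ℤ mod p → x ≡ 1
        ≡1⇒≡1 = mod-unique x<p 1<p

        ≡-1⇒≡q : + x ≡ -1ℤ mod p → x ≡ q
        ≡-1⇒≡q x≡-1 = mod-unique x<p q<p (mod-trans x≡-1 (mod-sym q≡-1))

        y = quotientMod 1ℤ x

        xy≡1 : + x * + y ≡ 1ℤ mod p
        xy≡1 = proj₂ (quotientMod-spec 1ℤ 0<x x<p)

      inverse-≢1 : x ≢ 1 → quotientMod 1ℤ x ≢ 1
      inverse-≢1 x≢1 y≡1 = x≢1 (≡1⇒≡1 (begin
        + x       ≡⟨ ℤ.*-identityʳ (+ x) ⟨
        + x * + 1 ≡⟨ cong (λ z → + x * + z) y≡1 ⟨
        + x * + y ≈⟨ xy≡1 ⟩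
        1ℤ        ∎))
        where open ≡-mod-Reasoning p

      inverse-≢-1 : x ≢ q → quotientMod 1ℤ x ≢ q
      inverse-≢-1 x≢q y≡q = x≢q (≡-1⇒≡q (begin
        + x            ≡⟨ ℤ.neg-involutive (+ x) ⟨
        - - + x        ≡⟨ cong -_ (ℤ.-1*i≡-i (+ x)) ⟨
        - (-1ℤ * + x)  ≡⟨ cong -_ (ℤ.*-comm -1ℤ (+ x)) ⟩
        - (+ x * -1ℤ)  ≈⟨ neg-cong-mod (*-congˡ-mod (+ x) q≡-1) ⟨
        - (+ x * + q)  ≡⟨ cong (λ z → - (+ x * + z)) y≡q ⟨
        - (+ x * + y)  ≈⟨ neg-cong-mod xy≡1 ⟩
        -1ℤ            ∎))
        where open ≡-mod-Reasoning p

      inverse-≢self : x ≢ 1 → x ≢ q → quotientMod 1ℤ x ≢ x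
      inverse-≢self x≢1 x≢q y≡x = [ x≢1 ∘ ≡1⇒≡1 , x≢q ∘ ≡-1⇒≡q ]′
        (square≡1⇒≡±1 (subst (λ z → + x * + z ≡ 1ℤ mod p) y≡x xy≡1))

    inverse-pairing : ∀ {q} → p ≡ suc q → Pairing p p (remove q (remove 1 positive)) (+_) 1ℤ
    inverse-pairing {q} p≡1+q = record
      { partner            = quotientMod 1ℤ
      ; partner-mapsTo     = λ {x} x<p Sx → let 0<x , x≢1 , x≢q = member Sx in
          proj₁ (quotientMod-spec 1ℤ 0<x x<p) ,
          remove⁺ (remove 1 positive) (remove⁺ positive (positive⁺ (quotientMod-positive 1≢0-mod 0<x x<p)) (inverse-≢1 p≡1+q 0<x x<p x≢1))
                    (inverse-≢-1 p≡1+q 0<x x<p x≢q)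
      ; partner-involutive = λ x<p Sx → quotientMod-involutive 1≢0-mod (proj₁ (member Sx)) x<p
      ; partner-≢          = λ x<p Sx → let 0<x , x≢1 , x≢q = member Sx in inverse-≢self p≡1+q 0<x x<p x≢1 x≢q
      ; partner-product    = λ x<p Sx → proj₂ (quotientMod-spec 1ℤ (proj₁ (member Sx)) x<p)
      }
      where
      member : ∀ {x} → remove q (remove 1 positive) x ≡ true → 0 < x × x ≢ 1 × x ≢ q
      member {x} Sx with S₁x , x≢q ← remove⁻ {q} {x} (remove 1 positive) Sx
                    with px , x≢1 ← remove⁻ {1} {x} positive S₁x = positive⁻ px , x≢1 , x≢q

    wilson : ∀ {m} → p ≡ suc (m ℕ.+ m) → prod p positive (+_) ≡ -1ℤ mod p
    wilson {zero} refl = contradiction refl (ℕ.nonTrivial⇒≢1 {{prime⇒nonTrivial p-prime}})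
    wilson {suc m} p≡1+q = begin
      prod p positive (+_)  ≡⟨ prod-remove (+_) 1<p refl ⟩
      1ℤ * prod p S₁ (+_)   ≡⟨ ℤ.*-identityˡ _ ⟩
      prod p S₁ (+_)        ≡⟨ prod-remove (+_) q<p S₁q ⟩
      + q * prod p S₂ (+_)  ≈⟨ *-cong-mod q≡-1 (prod-pairing m (inverse-pairing p≡1+q) #S₂) ⟩
      -1ℤ * 1ℤ ^ m          ≡⟨ cong (-1ℤ *_) (ℤ.^-zeroˡ m) ⟩
      -1ℤ                   ∎
      where
      open ≡-mod-Reasoning p
      q = suc m ℕ.+ suc m
      q<p : q < p
      q<p = subst (q <_) (sym p≡1+q) (ℕ.n<1+n q)
      q≡-1 : + q ≡ -1ℤ mod p
      q≡-1 = subst (λ n → + q ≡ -1ℤ mod n) (sym p≡1+q) (pred≡-1-mod q)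
      S₁ = remove 1 positive
      S₂ = remove q S₁
      S₁q : S₁ q ≡ true
      S₁q = remove⁺ positive refl q≢1
        where
        q≢1 : q ≢ 1
        q≢1 q≡1 with () ← trans (sym (ℕ.+-suc (suc m) m)) q≡1
      #S₂ : count p S₂ ≡ m ℕ.+ m
      #S₂ = count-remove-pred q<p S₁q (count-remove-pred 1<p refl
              (trans (cong (λ n → count n positive) p≡1+q) (trans (count-positive q) (ℕ.+-suc (suc m) m))))

    nonResidue⇒pow-half≡-1 : ∀ {m a} → p ≡ suc (m ℕ.+ m) → QuadraticNonResidue p a → a ^ m ≡ -1ℤ mod p
    nonResidue⇒pow-half≡-1 {m} {a} p≡1+2m nonResidue = begin
      a ^ m                 ≈⟨ prod-pairing m pairing #positive ⟨
      prod p positive (+_)  ≈⟨ wilson {m} p≡1+2m ⟩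
      -1ℤ                   ∎
      where
      open ≡-mod-Reasoning p
      a≢0 : ¬ a ≡ 0ℤ mod p
      a≢0 a≡0 = nonResidue 0 (ℕ.>-nonZero⁻¹ p) (mod-sym a≡0)
      #positive : count p positive ≡ m ℕ.+ m
      #positive = trans (cong (λ n → count n positive) p≡1+2m) (count-positive (m ℕ.+ m))
      spec : ∀ {x} → x < p → positive x ≡ true → quotientMod a x < p × + x * + quotientMod a x ≡ a mod p
      spec x<p px = quotientMod-spec a (positive⁻ px) x<p
      pairing : Pairing p p positive (+_) a
      pairing = record
        { partner            = quotientMod a
        ; partner-mapsTo     = λ x<p px →
            proj₁ (spec x<p px) , positive⁺ (quotientMod-positive a≢0 (positive⁻ px) x<p)
        ; partner-involutive = λ x<p px → quotientMod-involutive a≢0 (positive⁻ px) x<p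
        ; partner-≢          = λ {x} x<p px y≡x →
            nonResidue x x<p (subst (λ z → + x * + z ≡ a mod p) y≡x (proj₂ (spec x<p px)))
        ; partner-product    = λ x<p px → proj₂ (spec x<p px)
        }

  -- Gauss's lemma for the even non-multiples of p

  nonMultipleEven : (p : ℕ) .{{_ : NonZero p}} → ℕ → Bool
  nonMultipleEven p μ = not (μ % p ≡ᵇ 0) ∧ even μ

  oddResidue : (K : ℕ) .{{_ : NonZero K}} → ℤ → ℕ → Bool
  oddResidue K h μ = (h * + μ) %ℕ K % 2 ≡ᵇ 1

  module _ {p : ℕ} {{_ : NonZero p}} where

    nonMultipleEven⁻ : ∀ {μ} → nonMultipleEven p μ ≡ true → ¬ + μ ≡ 0ℤ mod p × μ % 2 ≡ 0
    nonMultipleEven⁻ {μ} _ with μ % p ≡ᵇ 0 in μ%p | μ % 2 ≡ᵇ 0 in μ%2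
    ... | false | true = ≡ᵇ-false⇒≢ μ%p ∘ ≡0-mod⇒%≡0 , ≡ᵇ-true⇒≡ μ%2

    nonMultipleEven⁺ : ∀ {μ} → ¬ + μ ≡ 0ℤ mod p → μ % 2 ≡ 0 → nonMultipleEven p μ ≡ true
    nonMultipleEven⁺ {μ} μ≢0 μ%2≡0 =
      cong₂ (λ a b → not a ∧ b) (≢⇒≡ᵇ-false (μ≢0 ∘ %≡⇒mod {p} {μ})) (≡⇒≡ᵇ-true μ%2≡0)

  module _ {p K : ℕ} {{_ : NonZero p}} {{_ : NonZero K}} (p-prime : Prime p) (p∣K : p ℕ.∣ K)
           (K-odd : K % 2 ≡ 1) {h : ℤ} (h⊥K : Coprime ∣ h ∣ K) where

    private
      E : ℕ → Bool
      E = nonMultipleEven p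

      O : ℕ → Bool
      O = oddResidue K h

      r : ℕ → ℕ
      r μ = (h * + μ) %ℕ K

      sign : ℕ → ℤ
      sign μ = if O μ then -1ℤ else 1ℤ

      -- Odd residues r are reflected to K ∸ r, which is even because K is odd.
      ψ : ℕ → ℕ
      ψ μ = if O μ then K ℕ.∸ r μ else r μ

      E⇒≢0 : ∀ {μ} → E μ ≡ true → ¬ + μ ≡ 0ℤ mod p
      E⇒≢0 = proj₁ ∘ nonMultipleEven⁻ {p}

      E⇒even : ∀ {μ} → E μ ≡ true → μ % 2 ≡ 0
      E⇒even = proj₂ ∘ nonMultipleEven⁻ {p}

      h≢0 : ¬ h ≡ 0ℤ mod p
      h≢0 h≡0 = ℕ.nonTrivial⇒≢1 {{prime⇒nonTrivial p-prime}} (h⊥K (∣⇒∣ᵤ (≡0-mod⇒∣ h≡0) , p∣K))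

      hμ≢0 : ∀ {μ} → E μ ≡ true → ¬ h * + μ ≡ 0ℤ mod p
      hμ≢0 Eμ = *-≢0-mod p-prime h≢0 (E⇒≢0 Eμ)

      h-cancel : ∀ {a b} → h * a ≡ h * b mod K → a ≡ b mod K
      h-cancel {a} {b} (mod-intro K∣ha-hb) = mod-intro (∣ᵤ⇒∣ (coprime-divisor (+ K) h (a - b) (coprime-sym h⊥K)
        (∣⇒∣ᵤ (subst (+ K ∣_) (identity h a b) K∣ha-hb))))
        where
        identity : ∀ h a b → h * a - h * b ≡ h * (a - b)
        identity = solve-∀

      residue-sign : ∀ μ → h * + μ ≡ sign μ * + ψ μ mod K
      residue-sign μ with O μ
      ... | false = mod-trans (mod-sym (%ℕ-mod (h * + μ))) (≡⇒mod (sym (ℤ.*-identityˡ _)))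
      ... | true  = begin
        h * + μ                 ≈⟨ %ℕ-mod (h * + μ) ⟨
        + r μ                   ≈⟨ mod-intro (divides 1ℤ (identity₁ (+ r μ) (+ K))) ⟩
        + r μ - + K             ≡⟨ identity₂ (+ r μ) (+ K) ⟩
        -1ℤ * (+ K - + r μ)     ≡⟨ cong (-1ℤ *_) (trans (ℤ.m-n≡m⊖n K (r μ)) (ℤ.⊖-≥ (ℕ.<⇒≤ (n%ℕd<d (h * + μ) K)))) ⟩
        -1ℤ * + (K ℕ.∸ r μ)     ∎
        where
        open ≡-mod-Reasoning K
        identity₁ : ∀ r K → r - (r - K) ≡ 1ℤ * K
        identity₁ = solve-∀
        identity₂ : ∀ r K → r - K ≡ -1ℤ * (K - r)
        identity₂ = solve-∀

      r<K : ∀ μ → r μ < K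
      r<K μ = n%ℕd<d (h * + μ) K

      r-positive : ∀ {μ} → E μ ≡ true → 0 < r μ
      r-positive {μ} Eμ = ℕ.n≢0⇒n>0 λ r≡0 →
        hμ≢0 Eμ (mod-divisor p∣K (mod-trans (mod-sym (%ℕ-mod (h * + μ))) (≡⇒mod (cong +_ r≡0))))

      ψ-< : ∀ {μ} → E μ ≡ true → ψ μ < K
      ψ-< {μ} Eμ with O μ
      ... | false = r<K μ
      ... | true  = ℕ.∸-monoʳ-< (r-positive Eμ) (ℕ.<⇒≤ (r<K μ))

      ψ-even : ∀ μ → ψ μ % 2 ≡ 0
      ψ-even μ with O μ in Oμ | parity (r μ)
      ... | true  | _           = odd∸odd (ℕ.<⇒≤ (r<K μ)) K-odd (≡ᵇ-true⇒≡ Oμ)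
      ... | false | inj₁ r%2≡0 = r%2≡0
      ... | false | inj₂ r%2≡1 = contradiction r%2≡1 (≡ᵇ-false⇒≢ Oμ)

      ψ-≢0 : ∀ {μ} → E μ ≡ true → ¬ + ψ μ ≡ 0ℤ mod p
      ψ-≢0 {μ} Eμ ψ≡0 = hμ≢0 Eμ (begin
        h * + μ        ≈⟨ mod-divisor p∣K (residue-sign μ) ⟩
        sign μ * + ψ μ ≈⟨ *-congˡ-mod (sign μ) ψ≡0 ⟩
        sign μ * 0ℤ    ≡⟨ ℤ.*-zeroʳ (sign μ) ⟩
        0ℤ             ∎)
        where open ≡-mod-Reasoning p

      ψ-mapsTo : MapsTo K E E ψ
      ψ-mapsTo {μ} _ Eμ = ψ-< Eμ , nonMultipleEven⁺ (ψ-≢0 Eμ) (ψ-even μ)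

      sum-≢0 : ∀ {x y} → x < K → y < K → E x ≡ true → E y ≡ true → ¬ + x + + y ≡ 0ℤ mod K
      sum-≢0 {x} {y} x<K y<K Ex Ey x+y≡0 with K∣x+y
        where
        K∣x+y : K ℕ.∣ x ℕ.+ y
        K∣x+y = subst (K ℕ.∣_) (cong ∣_∣ (sym (ℤ.pos-+ x y))) (∣⇒∣ᵤ (≡0-mod⇒∣ x+y≡0))
      ... | ℕ.divides zero        x+y≡0 =
        E⇒≢0 Ex (≡⇒mod (cong +_ (ℕ.m+n≡0⇒m≡0 x x+y≡0)))
      ... | ℕ.divides 1           x+y≡K = contradiction K-odd λ K%2≡1 → 0≢1 (begin
        0                ≡⟨ even+even {x} {y} (E⇒even Ex) (E⇒even Ey) ⟨
        (x ℕ.+ y) % 2    ≡⟨ cong (_% 2) (trans x+y≡K (ℕ.+-identityʳ K)) ⟩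
        K % 2            ≡⟨ K%2≡1 ⟩
        1                ∎)
        where
        open ≡-Reasoning
        0≢1 : 0 ≢ 1
        0≢1 ()
      ... | ℕ.divides (suc (suc q)) x+y≡[2+q]K = ℕ.<⇒≱ (ℕ.+-mono-< x<K y<K) (begin
        K ℕ.+ K                         ≤⟨ ℕ.+-monoʳ-≤ K (ℕ.m≤m+n K (q ℕ.* K)) ⟩
        suc (suc q) ℕ.* K               ≡⟨ x+y≡[2+q]K ⟨
        x ℕ.+ y                         ∎)
        where open ℕ.≤-Reasoning

      sign-cases : ∀ x y → sign x ≡ sign y ⊎ sign x ≡ - sign y
      sign-cases x y with O x | O y
      ... | false | false = inj₁ refl
      ... | true  | true  = inj₁ refl
      ... | false | true  = inj₂ refl
      ... | true  | false = inj₂ refl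

      ψ-injective : InjectiveOn K E ψ
      ψ-injective {x} {y} x<K y<K Ex Ey ψx≡ψy with sign-cases x y
      ... | inj₁ same = mod-unique x<K y<K (h-cancel (begin
        h * + x        ≈⟨ residue-sign x ⟩
        sign x * + ψ x ≡⟨ cong₂ (λ s t → s * + t) same ψx≡ψy ⟩
        sign y * + ψ y ≈⟨ residue-sign y ⟨
        h * + y        ∎))
        where open ≡-mod-Reasoning K
      ... | inj₂ opposite = ⊥-elim (sum-≢0 x<K y<K Ex Ey (h-cancel (begin
        h * (+ x + + y)                     ≡⟨ ℤ.*-distribˡ-+ h (+ x) (+ y) ⟩
        h * + x + h * + y                   ≈⟨ +-cong-mod (residue-sign x) (residue-sign y) ⟩
        sign x * + ψ x + sign y * + ψ y     ≡⟨ cong₂ (λ s t → s * + t + sign y * + ψ y) opposite ψx≡ψy ⟩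
        - sign y * + ψ y + sign y * + ψ y   ≡⟨ identity (sign y) (+ ψ y) ⟩
        0ℤ                                  ≡⟨ ℤ.*-zeroʳ h ⟨
        h * 0ℤ                              ∎)))
        where
        open ≡-mod-Reasoning K
        identity : ∀ s t → - s * t + s * t ≡ 0ℤ
        identity = solve-∀

    gauss-lemma : h ^ count K (nonMultipleEven p) ≡ -1ℤ ^ count K (λ μ → nonMultipleEven p μ ∧ oddResidue K h μ) mod p
    gauss-lemma = mod-cancelʳ p-prime (prod-≢0-mod p-prime K (+_) (λ _ → E⇒≢0)) (begin
      h ^ count K E * prod K E (+_)            ≡⟨ cong (_* prod K E (+_)) (prod-const K E h) ⟨
      prod K E (λ _ → h) * prod K E (+_)       ≡⟨ prod-* K E (λ _ → h) (+_) ⟨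
      prod K E (λ μ → h * + μ)                 ≈⟨ mod-divisor p∣K (prod-cong-mod K _ _ (λ {μ} _ _ → residue-sign μ)) ⟩
      prod K E (λ μ → sign μ * + ψ μ)          ≡⟨ prod-* K E sign (+_ ∘ ψ) ⟩
      prod K E sign * prod K E (+_ ∘ ψ)        ≡⟨ cong₂ _*_ (prod-sign K E O) (prod-reindex ψ (+_) refl ψ-mapsTo ψ-injective) ⟩
      -1ℤ ^ count K (λ μ → E μ ∧ O μ) * prod K E (+_) ∎)
      where open ≡-mod-Reasoning p

  -- Counting the even non-multiples of p

  module _ {p m : ℕ} {{_ : NonZero p}} (p≡1+2m : p ≡ suc (m ℕ.+ m)) where

    private
      E : ℕ → Bool
      E = nonMultipleEven p

      p%2≡1 : p % 2 ≡ 1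
      p%2≡1 = trans (cong (_% 2) p≡1+2m) (suc-double%2 m)

      not-≡ᵇ0 : ∀ i → not (i ≡ᵇ 0) ≡ positive i
      not-≡ᵇ0 zero    = refl
      not-≡ᵇ0 (suc _) = refl

      E-low : ∀ {i} → i < p → E i ≡ (positive i ∧ even i)
      E-low {i} i<p = trans (cong (λ j → not (j ≡ᵇ 0) ∧ even i) (ℕ.m<n⇒m%n≡m i<p)) (cong (_∧ even i) (not-≡ᵇ0 i))

      E-high : ∀ {i} → i < p → E (p ℕ.+ i) ≡ (positive i ∧ not (even i))
      E-high {i} i<p = trans
        (cong₂ (λ j b → not (j ≡ᵇ 0) ∧ b) (trans (ℕ.%-remove-+ˡ i (ℕ.∣-refl {p})) (ℕ.m<n⇒m%n≡m i<p)) (even-odd+ {p} i p%2≡1))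
        (cong (_∧ not (even i)) (not-≡ᵇ0 i))

      double : ∀ x → x ℕ.+ x ≡ x ℕ.* 2
      double = ℕ-Solver.solve-∀

      E-shift : ∀ {a} i → (p ℕ.+ p) ℕ.∣ a → E (a ℕ.+ i) ≡ E i
      E-shift i 2p∣a = cong₂ (λ j k → not (j ≡ᵇ 0) ∧ (k ≡ᵇ 0))
        (ℕ.%-remove-+ˡ i (ℕ.∣-trans (ℕ.∣m∣n⇒∣m+n (ℕ.∣-refl {p}) (ℕ.∣-refl {p})) 2p∣a))
        (ℕ.%-remove-+ˡ i (ℕ.∣-trans (ℕ.divides p (double p)) 2p∣a))

      count-low : count p E ≡ m
      count-low = begin
        count p E                             ≡⟨ count-ext p E-low ⟩
        count p (λ i → positive i ∧ even i)   ≡⟨ cong (λ n → count n (λ i → positive i ∧ even i)) p≡1+2m ⟩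
        count (suc (m ℕ.+ m)) (λ i → positive i ∧ even i) ≡⟨ count-positive-even m ⟩
        m                                     ∎
        where open ≡-Reasoning

      count-high : count p (λ i → E (p ℕ.+ i)) ≡ m
      count-high = ℕ.+-cancelˡ-≡ m _ _ (begin
        m ℕ.+ count p (λ i → E (p ℕ.+ i))     ≡⟨ cong₂ ℕ._+_ (sym count-low) (count-ext p E-high) ⟩
        count p E ℕ.+ count p (λ i → positive i ∧ not (even i)) ≡⟨ cong (ℕ._+ count p (λ i → positive i ∧ not (even i))) (count-ext p E-low) ⟩
        count p (λ i → positive i ∧ even i) ℕ.+ count p (λ i → positive i ∧ not (even i))
                                              ≡⟨ count-partition p (λ {i} _ → split (positive i) (even i)) (λ {i} _ → disjoint (positive i) (even i)) ⟩
        count p positive                      ≡⟨ cong (λ n → count n positive) p≡1+2m ⟩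
        count (suc (m ℕ.+ m)) positive        ≡⟨ count-positive (m ℕ.+ m) ⟩
        m ℕ.+ m                               ∎)
        where
        open ≡-Reasoning
        split : ∀ a b → a ≡ (a ∧ b) ∨ (a ∧ not b)
        split false _     = refl
        split true  false = refl
        split true  true  = refl
        disjoint : ∀ a b → (a ∧ b) ∧ (a ∧ not b) ≡ false
        disjoint false _     = refl
        disjoint true  false = refl
        disjoint true  true  = refl

      count-period : count (p ℕ.+ p) E ≡ m ℕ.+ m
      count-period = trans (count-+ p p E) (cong₂ ℕ._+_ count-low count-high)

    count-nonMultipleEven : ∀ {k} → k % 2 ≡ 1 → count (k ℕ.* p) (nonMultipleEven p) ≡ k ℕ.* m
    count-nonMultipleEven {k} k%2≡1 = begin
      count (k ℕ.* p) E                                   ≡⟨ cong (λ n → count n E) (k*x≡ p) ⟩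
      count (j ℕ.* (p ℕ.+ p) ℕ.+ p) E                     ≡⟨ count-+ (j ℕ.* (p ℕ.+ p)) p E ⟩
      count (j ℕ.* (p ℕ.+ p)) E ℕ.+ count p (λ i → E (j ℕ.* (p ℕ.+ p) ℕ.+ i))
        ≡⟨ cong₂ ℕ._+_ (count-periodic (p ℕ.+ p) E (λ i → E-shift i ℕ.∣-refl) j)
                       (count-ext p (λ {i} _ → E-shift i (ℕ.n∣m*n j))) ⟩
      j ℕ.* count (p ℕ.+ p) E ℕ.+ count p E               ≡⟨ cong₂ (λ a b → j ℕ.* a ℕ.+ b) count-period count-low ⟩
      j ℕ.* (m ℕ.+ m) ℕ.+ m                               ≡⟨ k*x≡ m ⟨
      k ℕ.* m                                             ∎
      where
      open ≡-Reasoning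
      j = k / 2
      k≡1+2j : k ≡ 1 ℕ.+ j ℕ.* 2
      k≡1+2j = trans (ℕ.m≡m%n+[m/n]*n k 2) (cong (ℕ._+ j ℕ.* 2) k%2≡1)
      identity : ∀ j x → (1 ℕ.+ j ℕ.* 2) ℕ.* x ≡ j ℕ.* (x ℕ.+ x) ℕ.+ x
      identity = ℕ-Solver.solve-∀
      k*x≡ : ∀ x → k ℕ.* x ≡ j ℕ.* (x ℕ.+ x) ℕ.+ x
      k*x≡ x = trans (cong (ℕ._* x) k≡1+2j) (identity j x)

  count-oddResidue-odd : ∀ {p k h} {{_ : NonZero p}} {{_ : NonZero (k ℕ.* p)}} → Prime p → p % 2 ≡ 1 →
                         (k ℕ.* p) % 2 ≡ 1 → Coprime ∣ h ∣ (k ℕ.* p) → QuadraticNonResidue p h →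
                         count (k ℕ.* p) (λ μ → nonMultipleEven p μ ∧ oddResidue (k ℕ.* p) h μ) % 2 ≡ 1
  count-oddResidue-odd {p} {k} {h} p-prime p-odd kp-odd h⊥kp nonResidue =
    -1^N≡-1⇒odd {p} {N} (odd-prime⇒>2 {m = m} p-prime p≡1+2m) (begin
      -1ℤ ^ N                                 ≈⟨ gauss-lemma p-prime (ℕ.n∣m*n k) kp-odd h⊥kp ⟨
      h ^ count (k ℕ.* p) (nonMultipleEven p) ≡⟨ cong (h ^_) (count-nonMultipleEven p≡1+2m {k} k-odd) ⟩
      h ^ (k ℕ.* m)                           ≡⟨ cong (h ^_) (ℕ.*-comm k m) ⟩
      h ^ (m ℕ.* k)                           ≡⟨ ℤ.^-*-assoc h m k ⟨
      (h ^ m) ^ k                             ≈⟨ ^-cong-mod k (nonResidue⇒pow-half≡-1 p-prime {m} p≡1+2m nonResidue) ⟩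
      -1ℤ ^ k                                 ≡⟨ -1^odd {k} k-odd ⟩
      -1ℤ                                     ∎)
    where
    open ≡-mod-Reasoning p
    N : ℕ
    N = count (k ℕ.* p) (λ μ → nonMultipleEven p μ ∧ oddResidue (k ℕ.* p) h μ)
    m : ℕ
    m = p / 2
    p≡1+2m : p ≡ suc (m ℕ.+ m)
    p≡1+2m = %2≡1⇒≡suc-double p-odd
    k-odd : k % 2 ≡ 1
    k-odd = odd-factorˡ k p kp-odd

  filter-absorb : ∀ {P Q : ℕ → Set} (P? : U.Decidable P) (Q? : U.Decidable Q) → (∀ {i} → P i → Q i) →
                  ∀ xs → filter P? (filter Q? xs) ≡ filter P? xs
  filter-absorb P? Q? P⇒Q []       = refl
  filter-absorb P? Q? P⇒Q (x ∷ xs) with Q? x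
  ... | no ¬Qx = trans (filter-absorb P? Q? P⇒Q xs) (sym (List.filter-reject P? (¬Qx ∘ P⇒Q)))
  ... | yes _ with P? x
  ...   | yes _ = cong (x ∷_) (filter-absorb P? Q? P⇒Q xs)
  ...   | no _  = filter-absorb P? Q? P⇒Q xs

  length-filter-upTo : ∀ n (P : ℕ → Bool) → length (filter (λ i → T? (P i)) (upTo n)) ≡ count n P
  length-filter-upTo zero    P = refl
  length-filter-upTo (suc n) P = begin
    length (filter P? (upTo (suc n)))                    ≡⟨ cong (length ∘ filter P?) (List.upTo-∷ʳ n) ⟨
    length (filter P? (upTo n ++ [ n ]))                 ≡⟨ cong length (List.filter-++ P? (upTo n) [ n ]) ⟩
    length (filter P? (upTo n) ++ filter P? [ n ])       ≡⟨ List.length-++ (filter P? (upTo n)) ⟩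
    length (filter P? (upTo n)) ℕ.+ length (filter P? [ n ]) ≡⟨ cong (ℕ._+ length (filter P? [ n ])) (length-filter-upTo n P) ⟩
    count n P ℕ.+ length (filter P? [ n ])               ≡⟨ last ⟩
    count (suc n) P                                      ∎
    where
    open ≡-Reasoning
    P? : U.Decidable (λ i → T (P i))
    P? i = T? (P i)
    last : count n P ℕ.+ length (filter P? [ n ]) ≡ count (suc n) P
    last with P n
    ... | true  = ℕ.+-comm (count n P) 1
    ... | false = ℕ.+-identityʳ (count n P)

  χ-union : ∀ A B S D → let χ = if A then + 0 else (if S then + 1 else -[1+ 0 ]) in
            (not A ∧ B) ∧ D ≡ (not A ∧ B ∧ does (χ ℤ.≟ + 1) ∧ D) ∨ (not A ∧ B ∧ does (χ ℤ.≟ -[1+ 0 ]) ∧ D)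
  χ-union true  _     _     _     = refl
  χ-union false false _     _     = refl
  χ-union false true  true  true  = refl
  χ-union false true  true  false = refl
  χ-union false true  false true  = refl
  χ-union false true  false false = refl

  χ-disjoint : ∀ A B S D → let χ = if A then + 0 else (if S then + 1 else -[1+ 0 ]) in
               (not A ∧ B ∧ does (χ ℤ.≟ + 1) ∧ D) ∧ (not A ∧ B ∧ does (χ ℤ.≟ -[1+ 0 ]) ∧ D) ≡ false
  χ-disjoint true  _     _     _     = refl
  χ-disjoint false false _     _     = refl
  χ-disjoint false true  true  true  = refl
  χ-disjoint false true  true  false = refl
  χ-disjoint false true  false true  = refl
  χ-disjoint false true  false false = refl

  τ-sum : ∀ {p K} {{_ : NonZero p}} {{_ : NonZero K}} h →
          τer p h K ℕ.+ τes p h K ≡ count K (λ μ → nonMultipleEven p μ ∧ oddResidue K h μ)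
  -- At successors, modN and modZ of Defs compute to _%_ and _%ℕ_, so the conditions match definitionally.
  τ-sum {suc p} {suc K} h = begin
    τer (suc p) h (suc K) ℕ.+ τes (suc p) h (suc K)
      ≡⟨ cong₂ ℕ._+_ (countCond≡count (+ 1)) (countCond≡count -[1+ 0 ]) ⟩
    count (suc K) (condᵇ (suc p) (+ 1) (suc K) h) ℕ.+ count (suc K) (condᵇ (suc p) -[1+ 0 ] (suc K) h)
      ≡⟨ count-partition (suc K) {condᵇ (suc p) (+ 1) (suc K) h} {condᵇ (suc p) -[1+ 0 ] (suc K) h}
                         (λ {μ} _ → χ-union (μ % suc p ≡ᵇ 0) (even μ) (isSquareMod (suc p) μ) (oddResidue (suc K) h μ))
                         (λ {μ} _ → χ-disjoint (μ % suc p ≡ᵇ 0) (even μ) (isSquareMod (suc p) μ) (oddResidue (suc K) h μ)) ⟩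
    count (suc K) (λ μ → nonMultipleEven (suc p) μ ∧ oddResidue (suc K) h μ) ∎
    where
    open ≡-Reasoning
    cond⇒positive : ∀ {c μ} → T (condᵇ (suc p) c (suc K) h μ) → 0 < μ
    cond⇒positive {μ = suc _} _ = ℕ.z<s
    countCond≡count : ∀ c → countCond (suc p) c (suc K) h ≡ count (suc K) (condᵇ (suc p) c (suc K) h)
    countCond≡count c = trans
      (cong length (filter-absorb (λ μ → T? (condᵇ (suc p) c (suc K) h μ)) (λ μ → 0 ℕ.<? μ) cond⇒positive (upTo (suc K))))
      (length-filter-upTo (suc K) (condᵇ (suc p) c (suc K) h))

  legendre-square≢-1 : ∀ {p a} → T (isSquareMod p a) → legendre p a ≢ -1ℤ
  legendre-square≢-1 {p} {a} square with modN a p ≡ᵇ 0 | isSquareMod p a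
  ... | true  | _    = λ ()
  ... | false | true = λ ()

  legendre≡-1⇒nonResidue : ∀ {p} {{_ : NonZero p}} h → legendre p (modZ h p) ≡ -1ℤ → QuadraticNonResidue p h
  legendre≡-1⇒nonResidue {suc p} h χ≡-1 x x<p x²≡h = legendre-square≢-1 {suc p} {h %ℕ suc p} square χ≡-1
    where
    open ≡-mod-Reasoning (suc p)
    x²≡a : (x ℕ.* x) % suc p ≡ (h %ℕ suc p) % suc p
    x²≡a = mod⇒%≡ (begin
      + (x ℕ.* x)     ≡⟨ ℤ.pos-* x x ⟩
      + x * + x       ≈⟨ x²≡h ⟩
      h               ≈⟨ %ℕ-mod h ⟨
      + (h %ℕ suc p)  ∎)
    square : T (isSquareMod (suc p) (h %ℕ suc p))
    square = any⁺ _ (Any.map (λ { refl → ℕ.≡⇒≡ᵇ _ _ x²≡a }) (∈-upTo⁺ x<p))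

open Proof

open import Data.Integer.Base as ℤ using (ℤ; ∣_∣)
open import Data.Nat using (ℕ; _*_; _+_; _%_)
open import Data.Nat.Base using (NonZero; >-nonZero)
open import Data.Nat.Coprimality using (Coprime)
open import Data.Nat.Primality using (Prime; prime⇒nonZero)
open import Data.Nat.Properties using (m*n≢0)
open import Relation.Binary.PropositionalEquality using (_≡_; sym; subst)

lemma16p3 : (p k : ℕ) (h : ℤ) → Prime p → p % 4 ≡ 1 → 1 Data.Nat.≤ k →
    (k * p) % 2 ≡ 1 → Coprime ∣ h ∣ (k * p) → legendre p (modZ h p) ≡ ℤ.-[1+ 0 ] →
    (τer p h (k * p) + τes p h (k * p)) % 2 ≡ 1
lemma16p3 p k h p-prime p%4≡1 1≤k kp-odd h⊥kp χh≡-1 =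
  subst (λ n → n % 2 ≡ 1) (sym (τ-sum {p} {k * p} h))
    (count-oddResidue-odd {k = k} p-prime (%4≡1⇒%2≡1 {p} p%4≡1) kp-odd h⊥kp (legendre≡-1⇒nonResidue h χh≡-1))
  where
  instance
    p≢0 : NonZero p
    p≢0 = prime⇒nonZero p-prime
    kp≢0 : NonZero (k * p)
    kp≢0 = m*n≢0 k p {{>-nonZero 1≤k}}
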